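{- Let $\mathcal{V}$ be the variety of combinatory algebras generated by the term model of $\lambda\pi\phi$. For every $\mathbf{A}\in\mathcal{V}$, writing $o$ for the element of $A$ denoted by the combinatory term $(SII)(SII)$ with $I\equiv SKK$ (the denotation of $\Omega$), every topology on $A$ that makes $\mathbf{A}$ a topological algebra which is $T_0$-separated in $o$ also makes it $T_{2\frac12}$-separated in $o$.
   Context: A combinatory algebra is $(A,\cdot,K,S)$ with binary application satisfying $Kxy=x$, $Sxyz=xz(yz)$. $\Omega\equiv(\lambda x.xx)(\lambda x.xx)$, $B \equiv \lambda x.x(\lambda y.yx)$, $C \equiv \lambda z.zB$, $\Theta\equiv BC$; $\lambda\pi\phi$ is the least $\lambda$-theory (congruence on $\lambda$-terms containing $\alpha\beta\eta$-conversion) containing $\Theta xx=\Omega$ and $\Theta x\Omega=x$; its term model is the set of $\lambda$-terms modulo $\lambda\pi\phi$ with application on classes (a combinatory algebra with $K=[\lambda xy.x]$, $S=[\lambda xyz.xz(yz)]$). The variety generated by an algebra is the least class containing it closed under subalgebras, homomorphic images and products. A topological algebra is one whose topology makes all basic operations continuous. A space is $T_i$-separated in a point $p$ if $p$ and $q$ are $T_i$-separated for every $q\ne p$; $T_0$-separated: one has a neighbourhood missing the other; $T_{2\frac12}$-separated: they have open neighbourhoods with disjoint closures. -}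

module Defs where

open import Level using (Level; _⊔_; suc; 0ℓ)
open import Data.Nat using (ℕ; zero) renaming (suc to sucℕ)
open import Data.Product using (Σ; _×_; _,_; ∃)
open import Data.Sum using (_⊎_)
open import Relation.Nullary using (¬_)
open import Relation.Binary using (IsEquivalence)
open import Data.Unit.Polymorphic using (⊤)
open import Data.Empty using (⊥)

-- λ-terms (de Bruijn indices, so α-conversion is syntactic identity)

infixl 7 _·_
data Λ : Set where
  var : ℕ → Λ
  _·_ : Λ → Λ → Λ
  ƛ   : Λ → Λ

ext : (ℕ → ℕ) → ℕ → ℕ
ext ρ zero     = zero
ext ρ (sucℕ n) = sucℕ (ρ n)

rename : (ℕ → ℕ) → Λ → Λ
rename ρ (var n) = var (ρ n)
rename ρ (M · N) = rename ρ M · rename ρ N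
rename ρ (ƛ M)   = ƛ (rename (ext ρ) M)

exts : (ℕ → Λ) → ℕ → Λ
exts σ zero     = var zero
exts σ (sucℕ n) = rename sucℕ (σ n)

subst : (ℕ → Λ) → Λ → Λ
subst σ (var n) = σ n
subst σ (M · N) = subst σ M · subst σ N
subst σ (ƛ M)   = ƛ (subst (exts σ) M)

sub0 : Λ → ℕ → Λ
sub0 N zero     = N
sub0 N (sucℕ n) = var n

_[_] : Λ → Λ → Λ
M [ N ] = subst (sub0 N) M

Ωλ : Λ
Ωλ = ƛ (var 0 · var 0) · ƛ (var 0 · var 0)

-- B ≡ λx. x (λy. y x)
Bλ : Λ
Bλ = ƛ (var 0 · ƛ (var 0 · var 1))

Cλ : Λ
Cλ = ƛ (var 0 · Bλ)

Θλ : Λ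
Θλ = Bλ · Cλ

infix 4 _≈πφ_
data _≈πφ_ : Λ → Λ → Set where
  β       : ∀ M N → ƛ M · N ≈πφ M [ N ]
  η       : ∀ M → ƛ (rename sucℕ M · var 0) ≈πφ M
  axπ     : ∀ M → Θλ · M · M ≈πφ Ωλ
  axφ     : ∀ M → Θλ · M · Ωλ ≈πφ M
  refl    : ∀ {M} → M ≈πφ M
  sym     : ∀ {M N} → M ≈πφ N → N ≈πφ M
  trans   : ∀ {M N P} → M ≈πφ N → N ≈πφ P → M ≈πφ P
  app-cong : ∀ {M M' N N'} → M ≈πφ M' → N ≈πφ N' → M · N ≈πφ M' · N'
  lam-cong : ∀ {M M'} → M ≈πφ M' → ƛ M ≈πφ ƛ M'

-- Algebras of the signature of combinatory algebras (·, K, S),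
-- with a setoid carrier (quotients are represented by setoids).

record Alg (a : Level) : Set (suc a) where
  infixl 7 _∙_
  infix 4 _≈_
  field
    Carrier : Set a
    _≈_     : Carrier → Carrier → Set a
    isEquiv : IsEquivalence _≈_
    _∙_     : Carrier → Carrier → Carrier
    K S     : Carrier
    ∙-cong  : ∀ {x x' y y'} → x ≈ x' → y ≈ y' → x ∙ y ≈ x' ∙ y'

IsCA : ∀ {a} → Alg a → Set a
IsCA A = (∀ x y → (K ∙ x) ∙ y ≈ x) × (∀ x y z → ((S ∙ x) ∙ y) ∙ z ≈ (x ∙ z) ∙ (y ∙ z))
  where open Alg A

TermModel : Alg 0ℓ
TermModel = record
  { Carrier = Λ
  ; _≈_ = _≈πφ_
  ; isEquiv = record { refl = refl ; sym = sym ; trans = trans }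
  ; _∙_ = _·_
  ; K = ƛ (ƛ (var 1))
  ; S = ƛ (ƛ (ƛ (var 2 · var 0 · (var 1 · var 0))))
  ; ∙-cong = app-cong
  }

record Hom {a b} (A : Alg a) (B : Alg b) : Set (a ⊔ b) where
  private
    module A = Alg A
    module B = Alg B
  field
    f      : A.Carrier → B.Carrier
    f-cong : ∀ {x y} → x A.≈ y → f x B.≈ f y
    f-∙    : ∀ x y → f (x A.∙ y) B.≈ (f x B.∙ f y)
    f-K    : f A.K B.≈ B.K
    f-S    : f A.S B.≈ B.S

Injective : ∀ {a b} {A : Alg a} {B : Alg b} → Hom A B → Set (a ⊔ b)
Injective {A = A} {B} h = ∀ x y → Hom.f h x B.≈ Hom.f h y → x A.≈ y
  where module A = Alg A ; module B = Alg B

Surjective : ∀ {a b} {A : Alg a} {B : Alg b} → Hom A B → Set (a ⊔ b)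
Surjective {A = A} {B} h = ∀ y → Σ (Alg.Carrier A) λ x → Hom.f h x B.≈ y
  where module B = Alg B

Π-Alg : ∀ {a} (I : Set a) → (I → Alg a) → Alg a
Π-Alg I F = record
  { Carrier = (i : I) → Alg.Carrier (F i)
  ; _≈_ = λ x y → ∀ i → Alg._≈_ (F i) (x i) (y i)
  ; isEquiv = record
      { refl  = λ i → IsEquivalence.refl (Alg.isEquiv (F i))
      ; sym   = λ p i → IsEquivalence.sym (Alg.isEquiv (F i)) (p i)
      ; trans = λ p q i → IsEquivalence.trans (Alg.isEquiv (F i)) (p i) (q i) }
  ; _∙_ = λ x y i → Alg._∙_ (F i) (x i) (y i)
  ; K = λ i → Alg.K (F i)
  ; S = λ i → Alg.S (F i)
  ; ∙-cong = λ p q i → Alg.∙-cong (F i) (p i) (q i)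
  }

-- The variety generated by the term model: the least class of algebras
-- (at carrier level a) containing (isomorphic copies of) the term model
-- and closed under homomorphic images, subalgebras (up to isomorphism,
-- i.e. injective homomorphisms) and products.
data InV {a} : Alg a → Set (suc a) where
  gen  : ∀ {A : Alg a} (h : Hom TermModel A) → Injective h → Surjective h → InV A
  himg : ∀ {A B : Alg a} → InV A → (h : Hom A B) → Surjective h → InV B
  subA : ∀ {A B : Alg a} → InV A → (h : Hom B A) → Injective h → InV B
  prod : (I : Set a) (F : I → Alg a) → (∀ i → InV (F i)) → InV (Π-Alg I F)

record Topology {a} (A : Alg a) (t : Level) : Set (suc a ⊔ suc t) where
  open Alg A
  field
    IsOpen    : (Carrier → Set a) → Set t
    saturated : ∀ {U} → IsOpen U → ∀ {x y} → x ≈ y → U x → U y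
    whole     : IsOpen (λ _ → ⊤ {a})
    inter     : ∀ {U V} → IsOpen U → IsOpen V → IsOpen (λ x → U x × V x)
    union     : ∀ {I : Set a} (U : I → Carrier → Set a) →
                (∀ i → IsOpen (U i)) → IsOpen (λ x → Σ I λ i → U i x)

module _ {a t} (A : Alg a) (τ : Topology A t) where
  open Alg A
  open Topology τ

  -- application A × A → A is continuous for the product topology
  -- (the constants K, S are trivially continuous)
  IsTopologicalAlgebra : Set (suc a ⊔ t)
  IsTopologicalAlgebra =
    ∀ (U : Carrier → Set a) → IsOpen U → ∀ x y → U (x ∙ y) →
      Σ (Carrier → Set a) λ V → Σ (Carrier → Set a) λ W →
        IsOpen V × IsOpen W × V x × W y ×
        (∀ u v → V u → W v → U (u ∙ v))

  closure : (Carrier → Set a) → Carrier → Set (suc a ⊔ t)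
  closure U x = ∀ (W : Carrier → Set a) → IsOpen W → W x → Σ Carrier λ y → W y × U y

  T0-sep : Carrier → Carrier → Set (suc a ⊔ t)
  T0-sep p q =
    (Σ (Carrier → Set a) λ U → IsOpen U × U p × ¬ U q) ⊎
    (Σ (Carrier → Set a) λ U → IsOpen U × U q × ¬ U p)

  T2½-sep : Carrier → Carrier → Set (suc a ⊔ t)
  T2½-sep p q =
    Σ (Carrier → Set a) λ U → Σ (Carrier → Set a) λ V →
      IsOpen U × IsOpen V × U p × V q ×
      (∀ x → closure U x → closure V x → ⊥)

  T0-in : Carrier → Set (suc a ⊔ t)
  T0-in p = ∀ q → ¬ (q ≈ p) → T0-sep p q

  T2½-in : Carrier → Set (suc a ⊔ t)
  T2½-in p = ∀ q → ¬ (q ≈ p) → T2½-sep p q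

module _ {a} (A : Alg a) where
  open Alg A
  Iₐ : Carrier
  Iₐ = S ∙ K ∙ K

  o : Carrier
  o = (S ∙ Iₐ ∙ Iₐ) ∙ (S ∙ Iₐ ∙ Iₐ)

module Submission where

-- The term model of
-- λπφ satisfies the two equations
--     Θ x x = o        and        Θ x o = x ,
-- and equations between combinatory terms survive homomorphic images,
-- subalgebras and products, so every algebra of the variety satisfies them.
-- The rest is topology: in a topological algebra with an element θ such
-- that θxx = p and θxp = x for all x, T₀-separation in p implies
-- T₂½-separation in p.  The binary polynomial (x , y) ↦ θxy is continuous,
-- takes the constant value p on the diagonal and sends (q , p) to q, so a
-- neighbourhood of p missing q (or of q missing p) pulls back to disjoint
-- neighbourhoods of p and q (Hausdorff separation); pulling back once more
-- gives neighbourhoods of p and q with disjoint closures.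

open import Defs
open import Data.Nat using (ℕ; zero) renaming (suc to sucℕ)
open import Data.Product using (Σ; _×_; _,_; proj₁; proj₂)
open import Data.Sum using (inj₁; inj₂)
open import Data.Empty using (⊥)
open import Relation.Binary using (IsEquivalence)
open import Relation.Nullary using (¬_)
import Relation.Binary.PropositionalEquality as P

infixl 7 _⊛_
data Comb : Set where
  k s : Comb
  _⊛_ : Comb → Comb → Comb

⟦_⟧ : ∀ {a} → Comb → (A : Alg a) → Alg.Carrier A
⟦ k ⟧     A = Alg.K A
⟦ s ⟧     A = Alg.S A
⟦ t ⊛ u ⟧ A = Alg._∙_ A (⟦ t ⟧ A) (⟦ u ⟧ A)

-- Bracket abstractions of I, B = λx.x(λy.yx), C = λz.zB, Θ = BC and
-- ω = λx.xx; the element o of Defs is literally ⟦ ω ⊛ ω ⟧.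
I-comb B-comb C-comb Θ-comb ω-comb : Comb
I-comb = s ⊛ k ⊛ k
B-comb = s ⊛ I-comb ⊛ (s ⊛ (k ⊛ (s ⊛ I-comb)) ⊛ (s ⊛ (k ⊛ k) ⊛ I-comb))
C-comb = s ⊛ I-comb ⊛ (k ⊛ B-comb)
Θ-comb = B-comb ⊛ C-comb
ω-comb = s ⊛ I-comb ⊛ I-comb

hom-⟦⟧ : ∀ {a b} {A : Alg a} {B : Alg b} (h : Hom A B) (t : Comb) →
  Alg._≈_ B (Hom.f h (⟦ t ⟧ A)) (⟦ t ⟧ B)
hom-⟦⟧ h k = Hom.f-K h
hom-⟦⟧ h s = Hom.f-S h
hom-⟦⟧ {B = B} h (t ⊛ u) =
  IsEquivalence.trans (Alg.isEquiv B) (Hom.f-∙ h _ _)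
    (Alg.∙-cong B (hom-⟦⟧ h t) (hom-⟦⟧ h u))

ΘΩ-laws : ∀ {a} → Alg a → Set a
ΘΩ-laws A = (∀ x → Θ ∙ x ∙ x ≈ o A) × (∀ x → Θ ∙ x ∙ o A ≈ x)
  where open Alg A
        Θ = ⟦ Θ-comb ⟧ A

module HomOnLaws {a b} {A : Alg a} {B : Alg b} (h : Hom A B) where
  private module A = Alg A
  open Alg B
  open IsEquivalence isEquiv renaming (refl to ≈-refl; sym to ≈-sym; trans to ≈-trans)
  open Hom h using (f; f-∙)

  f-o : f (o A) ≈ o B
  f-o = hom-⟦⟧ h (ω-comb ⊛ ω-comb)

  f-Θ : ∀ x y → f (⟦ Θ-comb ⟧ A A.∙ x A.∙ y) ≈ ⟦ Θ-comb ⟧ B ∙ f x ∙ f y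
  f-Θ x y = ≈-trans (f-∙ _ _) (∙-cong f-Θx ≈-refl)
    where
      f-Θx : f (⟦ Θ-comb ⟧ A A.∙ x) ≈ ⟦ Θ-comb ⟧ B ∙ f x
      f-Θx = ≈-trans (f-∙ _ _) (∙-cong (hom-⟦⟧ h Θ-comb) ≈-refl)

laws-image : ∀ {a b} {A : Alg a} {B : Alg b} →
  ΘΩ-laws A → (h : Hom A B) → Surjective h → ΘΩ-laws B
laws-image {A = A} {B} (Θ-diag , Θ-o) h onto = diag , right
  where
    open Alg B
    open IsEquivalence isEquiv renaming (refl to ≈-refl; sym to ≈-sym; trans to ≈-trans)
    open HomOnLaws h

    diag : ∀ y → ⟦ Θ-comb ⟧ B ∙ y ∙ y ≈ o B
    diag y with onto y
    ... | x , fx≈y = ≈-trans (∙-cong (∙-cong ≈-refl (≈-sym fx≈y)) (≈-sym fx≈y))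
                      (≈-trans (≈-sym (f-Θ x x)) (≈-trans (Hom.f-cong h (Θ-diag x)) f-o))

    right : ∀ y → ⟦ Θ-comb ⟧ B ∙ y ∙ o B ≈ y
    right y with onto y
    ... | x , fx≈y = ≈-trans (∙-cong (∙-cong ≈-refl (≈-sym fx≈y)) (≈-sym f-o))
                      (≈-trans (≈-sym (f-Θ x (o A))) (≈-trans (Hom.f-cong h (Θ-o x)) fx≈y))

laws-sub : ∀ {a b} {A : Alg a} {B : Alg b} →
  ΘΩ-laws A → (h : Hom B A) → Injective h → ΘΩ-laws B
laws-sub {A = A} {B = B} (Θ-diag , Θ-o) h inj = diag , right
  where
    module B = Alg B
    open Alg A
    open IsEquivalence isEquiv renaming (refl to ≈-refl; sym to ≈-sym; trans to ≈-trans)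
    open HomOnLaws h
    f = Hom.f h

    diag : ∀ x → ⟦ Θ-comb ⟧ B B.∙ x B.∙ x B.≈ o B
    diag x = inj _ _ (≈-trans (f-Θ x x) (≈-trans (Θ-diag (f x)) (≈-sym f-o)))

    right : ∀ x → ⟦ Θ-comb ⟧ B B.∙ x B.∙ o B B.≈ x
    right x = inj _ _ (≈-trans (f-Θ x (o B)) (≈-trans (∙-cong ≈-refl f-o) (Θ-o (f x))))

laws-prod : ∀ {a} (I : Set a) (F : I → Alg a) →
  (∀ i → ΘΩ-laws (F i)) → ΘΩ-laws (Π-Alg I F)
laws-prod I F laws = (λ x i → proj₁ (laws i) (x i)) , (λ x i → proj₂ (laws i) (x i))

-- One step of β-reduction (contracting the head redex, or reducing inside
-- the term when there is none); iterating it evaluates the closed terms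
-- above to the λ-terms B, C and λx.xx of the paper.
reduce : Λ → Λ
reduce (var n)          = var n
reduce (ƛ M)            = ƛ (reduce M)
reduce (ƛ M · N)        = M [ N ]
reduce (var n · N)      = var n · reduce N
reduce ((M · M') · N)   = reduce (M · M') · reduce N

reduce-sound : ∀ M → reduce M ≈πφ M
reduce-sound (var n)        = refl
reduce-sound (ƛ M)          = lam-cong (reduce-sound M)
reduce-sound (ƛ M · N)      = sym (β M N)
reduce-sound (var n · N)    = app-cong refl (reduce-sound N)
reduce-sound ((M · M') · N) = app-cong (reduce-sound (M · M')) (reduce-sound N)

reduce^ : ℕ → Λ → Λ
reduce^ zero     M = M
reduce^ (sucℕ n) M = reduce^ n (reduce M)

reduce^-sound : ∀ n M → reduce^ n M ≈πφ M
reduce^-sound zero     M = refl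
reduce^-sound (sucℕ n) M = trans (reduce^-sound n (reduce M)) (reduce-sound M)

by-reduction : ∀ n {M N} → reduce^ n M P.≡ N → M ≈πφ N
by-reduction n {M} M↠N = P.subst (M ≈πφ_) M↠N (sym (reduce^-sound n M))

B-denotes : ⟦ B-comb ⟧ TermModel ≈πφ Bλ
B-denotes = by-reduction 30 P.refl

C-denotes : ⟦ C-comb ⟧ TermModel ≈πφ Cλ
C-denotes = by-reduction 30 P.refl

ω-denotes : ⟦ ω-comb ⟧ TermModel ≈πφ ƛ (var 0 · var 0)
ω-denotes = by-reduction 30 P.refl

Θ-denotes : ⟦ Θ-comb ⟧ TermModel ≈πφ Θλ
Θ-denotes = app-cong B-denotes C-denotes

o-denotes : o TermModel ≈πφ Ωλ
o-denotes = app-cong ω-denotes ω-denotes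

laws-TermModel : ΘΩ-laws TermModel
laws-TermModel =
    (λ x → trans (app-cong (app-cong Θ-denotes refl) refl) (trans (axπ x) (sym o-denotes)))
  , (λ x → trans (app-cong (app-cong Θ-denotes refl) o-denotes) (axφ x))

laws-variety : ∀ {a} {A : Alg a} → InV A → ΘΩ-laws A
laws-variety (gen h _ onto)   = laws-image laws-TermModel h onto
laws-variety (himg v h onto)  = laws-image (laws-variety v) h onto
laws-variety (subA v h inj)   = laws-sub (laws-variety v) h inj
laws-variety (prod I F vs)    = laws-prod I F (λ i → laws-variety (vs i))

module Continuity {a t} (A : Alg a) (τ : Topology A t) where
  open Alg A
  open Topology τ

  Continuous : (Carrier → Carrier) → Set _
  Continuous f = ∀ U → IsOpen U → ∀ x → U (f x) →
    Σ (Carrier → Set a) λ V → IsOpen V × V x × (∀ u → V u → U (f u))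

  -- the same for maps of two variables, with the product topology;
  -- IsTopologicalAlgebra A τ is by definition Continuous₂ _∙_
  Continuous₂ : (Carrier → Carrier → Carrier) → Set _
  Continuous₂ g = ∀ U → IsOpen U → ∀ x y → U (g x y) →
    Σ (Carrier → Set a) λ V → Σ (Carrier → Set a) λ W →
      IsOpen V × IsOpen W × V x × W y × (∀ u v → V u → W v → U (g u v))

  fix-left : ∀ {g} → Continuous₂ g → ∀ c → Continuous (g c)
  fix-left g-cont c U oU x U[gcx] with g-cont U oU c x U[gcx]
  ... | V , W , _ , oW , Vc , Wx , VW⊆ = W , oW , Wx , λ u Wu → VW⊆ c u Vc Wu

  post-compose : ∀ {f g} → Continuous f → Continuous₂ g →
    Continuous₂ (λ x y → f (g x y))
  post-compose f-cont g-cont U oU x y U[fgxy] with f-cont U oU _ U[fgxy]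
  ... | N , oN , Ngxy , N⊆ with g-cont N oN x y Ngxy
  ...   | V , W , oV , oW , Vx , Wy , VW⊆ =
          V , W , oV , oW , Vx , Wy , λ u v Vu Wv → N⊆ _ (VW⊆ u v Vu Wv)

  pre-compose-left : ∀ {f g} → Continuous₂ g → Continuous f →
    Continuous₂ (λ x y → g (f x) y)
  pre-compose-left g-cont f-cont U oU x y U[gfxy] with g-cont U oU _ y U[gfxy]
  ... | N , W , oN , oW , Nfx , Wy , NW⊆ with f-cont N oN x Nfx
  ...   | V , oV , Vx , V⊆ =
          V , W , oV , oW , Vx , Wy , λ u v Vu Wv → NW⊆ _ v (V⊆ u Vu) Wv

module Separation {a t} (A : Alg a) (τ : Topology A t)
                  (∙-cont : IsTopologicalAlgebra A τ)
                  (p θ : Alg.Carrier A)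
                  (θ-diag : ∀ x → Alg._≈_ A (Alg._∙_ A (Alg._∙_ A θ x) x) p)
                  (θ-right : ∀ x → Alg._≈_ A (Alg._∙_ A (Alg._∙_ A θ x) p) x) where
  open Alg A
  open IsEquivalence isEquiv renaming (refl to ≈-refl; sym to ≈-sym; trans to ≈-trans)
  open Topology τ
  open Continuity A τ

  θ-cont : Continuous₂ (λ x y → θ ∙ x ∙ y)
  θ-cont = pre-compose-left ∙-cont (fix-left ∙-cont θ)

  HausdorffSep : Carrier → Set _
  HausdorffSep q =
    Σ (Carrier → Set a) λ P → Σ (Carrier → Set a) λ Q →
      IsOpen P × IsOpen Q × P p × Q q × (∀ y → P y → Q y → ⊥)

  -- A continuous g with g q p in an open U but no diagonal value g y y in U
  -- separates p and q: pull U back to a box V × W around (q , p).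
  separate-by : ∀ {g} → Continuous₂ g → ∀ {U q} → IsOpen U → U (g q p) →
    (∀ y → ¬ U (g y y)) → HausdorffSep q
  separate-by g-cont oU U[gqp] diagonal-outside with g-cont _ oU _ _ U[gqp]
  ... | V , W , oV , oW , Vq , Wp , VW⊆ =
    W , V , oW , oV , Wp , Vq , λ y Wy Vy → diagonal-outside y (VW⊆ y y Vy Wy)

  -- T₀ gives Hausdorff: if U ∋ q misses p use (x , y) ↦ θxy, which maps
  -- (q , p) to q and the diagonal to p; if U ∋ p misses q use
  -- (x , y) ↦ θq(θxy), which maps (q , p) to θqq = p and the diagonal to
  -- θqp = q.
  T0⇒Hausdorff : ∀ q → T0-sep A τ p q → HausdorffSep q
  T0⇒Hausdorff q (inj₂ (U , oU , Uq , ¬Up)) =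
    separate-by θ-cont oU (saturated oU (≈-sym (θ-right q)) Uq)
      λ y U[θyy] → ¬Up (saturated oU (θ-diag y) U[θyy])
  T0⇒Hausdorff q (inj₁ (U , oU , Up , ¬Uq)) =
    separate-by (post-compose (fix-left ∙-cont (θ ∙ q)) θ-cont) oU
      (saturated oU (≈-sym θq[θqp]≈p) Up)
      λ y U[θq[θyy]] → ¬Uq (saturated oU θq[θyy]≈q U[θq[θyy]])
    where
      θq[θqp]≈p : θ ∙ q ∙ (θ ∙ q ∙ p) ≈ p
      θq[θqp]≈p = ≈-trans (∙-cong ≈-refl (θ-right q)) (θ-diag q)

      θq[θyy]≈q : ∀ {y} → θ ∙ q ∙ (θ ∙ y ∙ y) ≈ q
      θq[θyy]≈q = ≈-trans (∙-cong ≈-refl (θ-diag _)) (θ-right q)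

  -- Hausdorff gives T₂½: with P ∋ p, Q ∋ q disjoint, take U ∋ p, V ∋ q with
  -- θVU ⊆ Q.  A point x in both closures has a box N₁ × N₂ around (x , x)
  -- with θN₁N₂ ⊆ P (as θxx = p); picking y ∈ N₁ ∩ V and z ∈ N₂ ∩ U puts
  -- θyz in P ∩ Q.
  Hausdorff⇒T2½ : ∀ q → HausdorffSep q → T2½-sep A τ p q
  Hausdorff⇒T2½ q (P , Q , oP , oQ , Pp , Qq , P∩Q=∅)
    with θ-cont Q oQ q p (saturated oQ (≈-sym (θ-right q)) Qq)
  ... | V , U , oV , oU , Vq , Up , θVU⊆Q = U , V , oU , oV , Up , Vq , closures-disjoint
    where
      closures-disjoint : ∀ x → closure A τ U x → closure A τ V x → ⊥
      closures-disjoint x x∈clU x∈clV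
        with θ-cont P oP x x (saturated oP (≈-sym (θ-diag x)) Pp)
      ... | N₁ , N₂ , oN₁ , oN₂ , N₁x , N₂x , θN₁N₂⊆P
        with x∈clV N₁ oN₁ N₁x | x∈clU N₂ oN₂ N₂x
      ... | y , N₁y , Vy | z , N₂z , Uz =
        P∩Q=∅ _ (θN₁N₂⊆P y z N₁y N₂z) (θVU⊆Q y z Vy Uz)

  T0⇒T2½ : T0-in A τ p → T2½-in A τ p
  T0⇒T2½ t0 q q≉p = Hausdorff⇒T2½ q (T0⇒Hausdorff q (t0 q q≉p))

corollary6p12 : ∀ {a t} (A : Alg a) → InV A →
    (τ : Topology A t) → IsTopologicalAlgebra A τ →
    T0-in A τ (o A) → T2½-in A τ (o A)
corollary6p12 A A∈V τ ∙-cont =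
  Separation.T0⇒T2½ A τ ∙-cont (o A) (⟦ Θ-comb ⟧ A) (proj₁ laws) (proj₂ laws)
  where
    laws : ΘΩ-laws A
    laws = laws-variety A∈V
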